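{- Let $n = p^k m^2$ be an odd perfect number, where $p$ is prime, $p \equiv k \equiv 1 \pmod 4$ and $\gcd(p,m)=1$. Then: (1) If $p \equiv k \equiv 1 \pmod 8$, then $\sigma(m^2) \equiv 3 \pmod 4$ is impossible. (2) If $p \equiv 1 \pmod 8$ and $k \equiv 5 \pmod 8$, then $\sigma(m^2) \equiv 1 \pmod 4$ is impossible. (3) If $p \equiv 5 \pmod 8$ and $k \equiv 1 \pmod 8$, then $\sigma(m^2) \equiv 1 \pmod 4$ is impossible. (4) If $p \equiv k \equiv 5 \pmod 8$, then $\sigma(m^2) \equiv 3 \pmod 4$ is impossible.
   Context: $\sigma(z)$ denotes the sum of the positive divisors of $z$. An odd perfect number is an odd positive integer $n$ with $\sigma(n) = 2n$. By Euler, any odd perfect number has the form $n = p^k m^2$ with $p$ prime, $p \equiv k \equiv 1 \pmod 4$ and $\gcd(p,m)=1$; $p$ is called the special prime. -}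

module Defs where

open import Data.Nat using (ℕ; suc; _+_)
open import Data.Nat.Divisibility using (_∣?_)
open import Data.List using (List; filter; map; upTo)
open import Data.Nat.ListAction using (sum)

divisors : ℕ → List ℕ
divisors n = filter (_∣? n) (map suc (upTo n))

σ : ℕ → ℕ
σ n = sum (divisors n)

-- σ(p^k m²) = σ(m²)(1 + p + ⋯ + p^k) because p ∤ m², and p^k m² ≡ 1 (mod 4), so
-- σ(m²)(1 + p + ⋯ + p^k) = 2 p^k m² ≡ 2 (mod 8). The residue of 1 + p + ⋯ + p^k mod 8 is
-- periodic in k with period 8 and depends only on p mod 8; in the four cases it is 2, 6, 6, 2,
-- which forces σ(m²) ≡ 1, 3, 3, 1 (mod 4) respectively.
module Submission where

open import Defs
open import Data.Nat using (ℕ; zero; suc; _+_; _*_; _^_; _%_; _/_; _<_; s≤s; NonZero; ≢-nonZero⁻¹)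
open import Data.Nat.Properties
open import Data.Nat.DivMod
open import Data.Nat.Divisibility
open import Data.Nat.Tactic.RingSolver using (solve-∀)
open import Algebra.Properties.CommutativeSemigroup *-commutativeSemigroup using (x∙yz≈y∙xz)
open import Data.Nat.Primality using (Prime; prime⇒nonZero; prime⇒irreducible; euclidsLemma; ¬prime[1])
open import Data.Nat.Coprimality using (Coprime; coprime-divisor)
open import Data.Nat.ListAction using (sum)
open import Data.Nat.ListAction.Properties using (sum-↭; sum-++)
open import Data.List using (List; []; _∷_; _++_; map; upTo)
open import Data.List.Membership.Propositional using (_∈_)
open import Data.List.Membership.Propositional.Properties
open import Data.List.Membership.Propositional.Properties.WithK using (unique∧set⇒bag)
open import Data.List.Relation.Binary.BagAndSetEquality using (_∼[_]_; set; ∼bag⇒↭)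
open import Data.List.Relation.Unary.Unique.Propositional using (Unique)
import Data.List.Relation.Unary.Unique.Propositional.Properties as Unique
open import Data.Product using (_×_; _,_; proj₂)
open import Data.Sum using (inj₁; inj₂; [_,_])
open import Data.Empty using (⊥-elim)
open import Function.Bundles using (mk⇔)
open import Relation.Binary.PropositionalEquality hiding ([_])
open import Relation.Nullary using (¬_; yes; no)

open ≡-Reasoning

private
  variable
    a b d m n p x y : ℕ

divisors-unique : ∀ n → Unique (divisors n)
divisors-unique n = Unique.filter⁺ (_∣? n) (Unique.map⁺ suc-injective (Unique.upTo⁺ n))

∈-divisors⁻ : d ∈ divisors n → d ∣ n
∈-divisors⁻ {n = n} d∈ = proj₂ (∈-filter⁻ (_∣? n) {xs = map suc (upTo n)} d∈)

∈-divisors⁺ : .{{NonZero n}} → d ∣ n → d ∈ divisors n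
∈-divisors⁺ {n = n} {d = zero}  0∣n = ⊥-elim (≢-nonZero⁻¹ n (0∣⇒≡0 0∣n))
∈-divisors⁺ {n = n} {d = suc d} d∣n = ∈-filter⁺ (_∣? n) (∈-map⁺ suc (∈-upTo⁺ (∣⇒≤ d∣n))) d∣n

sum-unique-set : {xs ys : List ℕ} → Unique xs → Unique ys → xs ∼[ set ] ys → sum xs ≡ sum ys
sum-unique-set xs! ys! xs≈ys = sum-↭ (∼bag⇒↭ (unique∧set⇒bag xs! ys! xs≈ys))

sum-map-*ˡ : ∀ c xs → sum (map (c *_) xs) ≡ c * sum xs
sum-map-*ˡ c []       = sym (*-zeroʳ c)
sum-map-*ˡ c (x ∷ xs) = trans (cong (c * x +_) (sum-map-*ˡ c xs)) (sym (*-distribˡ-+ c x (sum xs)))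

prime∤⇒coprime : Prime p → ¬ p ∣ d → Coprime d p
prime∤⇒coprime p-prime p∤d (i∣d , i∣p) with prime⇒irreducible p-prime i∣p
... | inj₁ i≡1 = i≡1
... | inj₂ refl = ⊥-elim (p∤d i∣d)

prime∤-∣^*⇒∣ : Prime p → ¬ p ∣ d → ∀ k → d ∣ p ^ k * n → d ∣ n
prime∤-∣^*⇒∣ {d = d} {n = n} p-prime p∤d zero    d∣ = subst (d ∣_) (*-identityˡ n) d∣
prime∤-∣^*⇒∣ {p = p} {d = d} {n = n} p-prime p∤d (suc k) d∣ =
  prime∤-∣^*⇒∣ p-prime p∤d k
    (coprime-divisor (prime∤⇒coprime p-prime p∤d) (subst (d ∣_) (*-assoc p (p ^ k) n) d∣))

geometric : ℕ → ℕ → ℕ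
geometric p zero    = 1
geometric p (suc k) = 1 + p * geometric p k

-- Divisors of p^(k+1) n not divisible by p divide n; the others are p times a divisor of p^k n.
σ-p^[1+k]*n : Prime p → ¬ p ∣ n → .{{NonZero n}} →
              ∀ k → σ (p ^ suc k * n) ≡ σ n + p * σ (p ^ k * n)
σ-p^[1+k]*n {p = p} {n = n} p-prime p∤n k = begin
    σ (p * p ^ k * n)
  ≡⟨ sum-unique-set (divisors-unique (p * p ^ k * n)) split-unique (mk⇔ into from) ⟩
    sum (divisors n ++ map (p *_) (divisors (p ^ k * n)))
  ≡⟨ sum-++ (divisors n) _ ⟩
    σ n + sum (map (p *_) (divisors (p ^ k * n)))
  ≡⟨ cong (σ n +_) (sum-map-*ˡ p (divisors (p ^ k * n))) ⟩
    σ n + p * σ (p ^ k * n) ∎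
  where
  instance
    _ : NonZero p
    _ = prime⇒nonZero p-prime
    _ : NonZero (p ^ k)
    _ = m^n≢0 p k
    _ : NonZero (p ^ suc k)
    _ = m^n≢0 p (suc k)
    _ : NonZero (p ^ k * n)
    _ = m*n≢0 (p ^ k) n
    _ : NonZero (p * p ^ k * n)
    _ = m*n≢0 (p * p ^ k) n
  p^k*n : ℕ
  p^k*n = p ^ k * n

  assoc : p * p ^ k * n ≡ p * p^k*n
  assoc = *-assoc p (p ^ k) n

  split-unique : Unique (divisors n ++ map (p *_) (divisors p^k*n))
  split-unique = Unique.++⁺ (divisors-unique n)
    (Unique.map⁺ (λ {x} {y} → *-cancelˡ-≡ x y p) (divisors-unique p^k*n))
    λ { (x∈ , px∈) → p∤n (disjoint x∈ px∈) }
    where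
    disjoint : ∀ {x} → x ∈ divisors n → x ∈ map (p *_) (divisors p^k*n) → p ∣ n
    disjoint x∈ px∈ with ∈-map⁻ (p *_) px∈
    ... | e , _ , refl = ∣-trans (m∣m*n e) (∈-divisors⁻ x∈)

  into : ∀ {x} → x ∈ divisors (p * p ^ k * n) → x ∈ divisors n ++ map (p *_) (divisors p^k*n)
  into {x} x∈ with p ∣? x
  ... | no p∤x = ∈-++⁺ˡ (∈-divisors⁺ (prime∤-∣^*⇒∣ p-prime p∤x (suc k) (∈-divisors⁻ x∈)))
  ... | yes (divides q refl) = ∈-++⁺ʳ (divisors n)
    (subst (_∈ map (p *_) (divisors p^k*n)) (*-comm p q)
      (∈-map⁺ (p *_) (∈-divisors⁺ (*-cancelˡ-∣ p
        (subst₂ _∣_ (*-comm q p) assoc (∈-divisors⁻ x∈))))))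

  from : ∀ {x} → x ∈ divisors n ++ map (p *_) (divisors p^k*n) → x ∈ divisors (p * p ^ k * n)
  from x∈ with ∈-++⁻ (divisors n) x∈
  ... | inj₁ x∈n = ∈-divisors⁺ (∣-trans (∈-divisors⁻ x∈n) (n∣m*n (p * p ^ k)))
  ... | inj₂ x∈p* with ∈-map⁻ (p *_) x∈p*
  ...   | e , e∈ , refl = ∈-divisors⁺ (subst (p * e ∣_) (sym assoc) (*-monoʳ-∣ p (∈-divisors⁻ e∈)))

σ-p^k*n : Prime p → ¬ p ∣ n → .{{NonZero n}} → ∀ k → σ (p ^ k * n) ≡ σ n * geometric p k
σ-p^k*n {p = p} {n = n} p-prime p∤n zero = trans (cong σ (*-identityˡ n)) (sym (*-identityʳ (σ n)))
σ-p^k*n {p = p} {n = n} p-prime p∤n (suc k) = begin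
    σ (p ^ suc k * n)
  ≡⟨ σ-p^[1+k]*n p-prime p∤n k ⟩
    σ n + p * σ (p ^ k * n)
  ≡⟨ cong (λ t → σ n + p * t) (σ-p^k*n p-prime p∤n k) ⟩
    σ n + p * (σ n * geometric p k)
  ≡⟨ cong (σ n +_) (x∙yz≈y∙xz p (σ n) (geometric p k)) ⟩
    σ n + σ n * (p * geometric p k)
  ≡⟨ cong (_+ σ n * (p * geometric p k)) (sym (*-identityʳ (σ n))) ⟩
    σ n * 1 + σ n * (p * geometric p k)
  ≡⟨ sym (*-distribˡ-+ (σ n) 1 (p * geometric p k)) ⟩
    σ n * geometric p (suc k) ∎

*-cong-% : .{{_ : NonZero d}} → a % d ≡ b % d → x % d ≡ y % d → (a * x) % d ≡ (b * y) % d
*-cong-% {d = d} {a = a} {b = b} {x = x} {y = y} a≡b x≡y = begin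
  (a * x) % d               ≡⟨ %-distribˡ-* a x d ⟩
  (a % d * (x % d)) % d     ≡⟨ cong₂ (λ u v → (u * v) % d) a≡b x≡y ⟩
  (b % d * (y % d)) % d     ≡⟨ %-distribˡ-* b y d ⟨
  (b * y) % d               ∎

+-cong-% : .{{_ : NonZero d}} → a % d ≡ b % d → x % d ≡ y % d → (a + x) % d ≡ (b + y) % d
+-cong-% {d = d} {a = a} {b = b} {x = x} {y = y} a≡b x≡y = begin
  (a + x) % d               ≡⟨ %-distribˡ-+ a x d ⟩
  (a % d + x % d) % d       ≡⟨ cong₂ (λ u v → (u + v) % d) a≡b x≡y ⟩
  (b % d + y % d) % d       ≡⟨ %-distribˡ-+ b y d ⟨
  (b + y) % d               ∎

geometric-% : ∀ d .{{_ : NonZero d}} p k → geometric p k % d ≡ geometric (p % d) k % d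
geometric-% d p zero    = refl
geometric-% d p (suc k) =
  +-cong-% {a = 1} refl (*-cong-% (sym (m%n%n≡m%n p d)) (geometric-% d p k))

geometric-+-period : .{{_ : NonZero d}} → ∀ P → geometric p P % d ≡ 1 % d →
                     ∀ k → geometric p (k + P) % d ≡ geometric p k % d
geometric-+-period P period zero    = period
geometric-+-period {p = p} P period (suc k) =
  +-cong-% {a = 1} refl (*-cong-% {a = p} refl (geometric-+-period P period k))

geometric-%-period : .{{_ : NonZero d}} → ∀ P .{{_ : NonZero P}} → geometric p P % d ≡ 1 % d →
                     ∀ k → geometric p k % d ≡ geometric p (k % P) % d
geometric-%-period {d = d} {p = p} P period k = begin
  geometric p k % d                     ≡⟨ cong (λ t → geometric p t % d) (m≡m%n+[m/n]*n k P) ⟩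
  geometric p (k % P + k / P * P) % d   ≡⟨ drop-multiple (k % P) (k / P) ⟩
  geometric p (k % P) % d               ∎
  where
  drop-multiple : ∀ j q → geometric p (j + q * P) % d ≡ geometric p j % d
  drop-multiple j zero    = cong (λ t → geometric p t % d) (+-identityʳ j)
  drop-multiple j (suc q) = begin
    geometric p (j + (P + q * P)) % d   ≡⟨ cong (λ t → geometric p t % d) (shuffle j) ⟩
    geometric p (j + q * P + P) % d     ≡⟨ geometric-+-period P period (j + q * P) ⟩
    geometric p (j + q * P) % d         ≡⟨ drop-multiple j q ⟩
    geometric p j % d                   ∎
    where
    shuffle : ∀ j → j + (P + q * P) ≡ j + q * P + P
    shuffle j = trans (cong (j +_) (+-comm P (q * P))) (sym (+-assoc j (q * P) P))

geometric-%-reduce : ∀ d .{{_ : NonZero d}} P .{{_ : NonZero P}} → geometric (p % d) P % d ≡ 1 % d →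
                     ∀ k → geometric p k % d ≡ geometric (p % d) (k % P) % d
geometric-%-reduce {p = p} d P period k = begin
  geometric p k % d                   ≡⟨ geometric-%-period P (trans (geometric-% d p P) period) k ⟩
  geometric p (k % P) % d             ≡⟨ geometric-% d p (k % P) ⟩
  geometric (p % d) (k % P) % d       ∎

^-%-≡1 : .{{_ : NonZero d}} → a % d ≡ 1 % d → ∀ k → (a ^ k) % d ≡ 1 % d
^-%-≡1 a≡1 zero    = refl
^-%-≡1 a≡1 (suc k) = *-cong-% a≡1 (^-%-≡1 a≡1 k)

odd⇒nonZero : n % 2 ≡ 1 → NonZero n
odd⇒nonZero {suc n} _ = _

odd-*ʳ : ∀ a b → (a * b) % 2 ≡ 1 → b % 2 ≡ 1
odd-*ʳ a b ab-odd with b % 2 in b%2 | m%n<n b 2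
... | 1 | _ = refl
... | suc (suc _) | s≤s (s≤s ())
... | 0 | _ with () ← trans (sym ab-odd) (begin
  (a * b) % 2             ≡⟨ *-cong-% {a = a} {b = a} {x = b} {y = 0} refl b%2 ⟩
  (a * 0) % 2             ≡⟨ cong (_% 2) (*-zeroʳ a) ⟩
  0                       ∎)

odd-square : ∀ m → m % 2 ≡ 1 → (m * m) % 4 ≡ 1
odd-square m m-odd = begin
  (m * m) % 4                               ≡⟨ cong (λ t → (t * t) % 4) m≡1+2q ⟩
  ((1 + q * 2) * (1 + q * 2)) % 4           ≡⟨ cong (_% 4) (square q) ⟩
  (1 + (q + q * q) * 4) % 4                 ≡⟨ [m+kn]%n≡m%n 1 (q + q * q) 4 ⟩
  1                                         ∎
  where
  q : ℕ
  q = m / 2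
  m≡1+2q : m ≡ 1 + q * 2
  m≡1+2q = trans (m≡m%n+[m/n]*n m 2) (cong (_+ q * 2) m-odd)
  square : ∀ q → (1 + q * 2) * (1 + q * 2) ≡ 1 + (q + q * q) * 4
  square = solve-∀

double-%8 : ∀ a → a % 4 ≡ 1 → (2 * a) % 8 ≡ 2
double-%8 a a≡1 = begin
  (2 * a) % 8     ≡⟨ cong (_% 8) (*-comm 2 a) ⟩
  (a * 2) % 8     ≡⟨ m%n*o≡m*o%[n*o] a 4 2 ⟨
  a % 4 * 2       ≡⟨ cong (_* 2) a≡1 ⟩
  2               ∎

[t*2]%8≡2⇒t%4≡1 : ∀ t → t < 8 → (t * 2) % 8 ≡ 2 → t % 4 ≡ 1
[t*2]%8≡2⇒t%4≡1 1 _ _ = refl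
[t*2]%8≡2⇒t%4≡1 5 _ _ = refl
[t*2]%8≡2⇒t%4≡1 0 _ ()
[t*2]%8≡2⇒t%4≡1 2 _ ()
[t*2]%8≡2⇒t%4≡1 3 _ ()
[t*2]%8≡2⇒t%4≡1 4 _ ()
[t*2]%8≡2⇒t%4≡1 6 _ ()
[t*2]%8≡2⇒t%4≡1 7 _ ()
[t*2]%8≡2⇒t%4≡1 (suc (suc (suc (suc (suc (suc (suc (suc _)))))))) (s≤s (s≤s (s≤s (s≤s (s≤s (s≤s (s≤s (s≤s ())))))))) _

[t*6]%8≡2⇒t%4≡3 : ∀ t → t < 8 → (t * 6) % 8 ≡ 2 → t % 4 ≡ 3
[t*6]%8≡2⇒t%4≡3 3 _ _ = refl
[t*6]%8≡2⇒t%4≡3 7 _ _ = refl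
[t*6]%8≡2⇒t%4≡3 0 _ ()
[t*6]%8≡2⇒t%4≡3 1 _ ()
[t*6]%8≡2⇒t%4≡3 2 _ ()
[t*6]%8≡2⇒t%4≡3 4 _ ()
[t*6]%8≡2⇒t%4≡3 5 _ ()
[t*6]%8≡2⇒t%4≡3 6 _ ()
[t*6]%8≡2⇒t%4≡3 (suc (suc (suc (suc (suc (suc (suc (suc _)))))))) (s≤s (s≤s (s≤s (s≤s (s≤s (s≤s (s≤s (s≤s ())))))))) _

%4≡%8%4 : ∀ a → a % 4 ≡ a % 8 % 4
%4≡%8%4 a = sym (m∣n⇒o%n%m≡o%m 4 8 a (divides 2 refl))

[a*b]%8≡2⇒a%4≡1 : ∀ a b → (a * b) % 8 ≡ 2 → b % 8 ≡ 2 → a % 4 ≡ 1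
[a*b]%8≡2⇒a%4≡1 a b ab≡2 b≡2 = trans (%4≡%8%4 a)
  ([t*2]%8≡2⇒t%4≡1 (a % 8) (m%n<n a 8) (trans (*-cong-% {a = a % 8} {b = a} {y = b} (m%n%n≡m%n a 8) (sym b≡2)) ab≡2))

[a*b]%8≡2⇒a%4≡3 : ∀ a b → (a * b) % 8 ≡ 2 → b % 8 ≡ 6 → a % 4 ≡ 3
[a*b]%8≡2⇒a%4≡3 a b ab≡2 b≡6 = trans (%4≡%8%4 a)
  ([t*6]%8≡2⇒t%4≡3 (a % 8) (m%n<n a 8) (trans (*-cong-% {a = a % 8} {b = a} {y = b} (m%n%n≡m%n a 8) (sym b≡6)) ab≡2))

prime∤m*m : Prime p → Coprime p m → ¬ p ∣ m * m
prime∤m*m {p = p} {m = m} p-prime p⊥m p∣m*m = [ p∤m , p∤m ] (euclidsLemma m m p-prime p∣m*m)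
  where
  p∤m : ¬ p ∣ m
  p∤m p∣m = ¬prime[1] (subst Prime (p⊥m (∣-refl , p∣m)) p-prime)

σ[m²]*geometric%8≡2 : Prime p → p % 4 ≡ 1 → Coprime p m → ∀ k →
                      (p ^ k * (m * m)) % 2 ≡ 1 → σ (p ^ k * (m * m)) ≡ 2 * (p ^ k * (m * m)) →
                      (σ (m * m) * geometric p k) % 8 ≡ 2
σ[m²]*geometric%8≡2 {p = p} {m = m} p-prime p≡1 p⊥m k n-odd perfect = begin
  (σ m² * geometric p k) % 8   ≡⟨ cong (_% 8) (σ-p^k*n p-prime (prime∤m*m p-prime p⊥m) k) ⟨
  σ (p ^ k * m²) % 8           ≡⟨ cong (_% 8) perfect ⟩
  (2 * (p ^ k * m²)) % 8       ≡⟨ double-%8 (p ^ k * m²) n≡1 ⟩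
  2                            ∎
  where
  m² : ℕ
  m² = m * m
  m²-odd : m² % 2 ≡ 1
  m²-odd = odd-*ʳ (p ^ k) m² n-odd
  instance
    _ : NonZero m²
    _ = odd⇒nonZero m²-odd
  n≡1 : (p ^ k * m²) % 4 ≡ 1
  n≡1 = *-cong-% {a = p ^ k} {b = 1} {x = m²} {y = 1} (^-%-≡1 p≡1 k) (odd-square m (odd-*ʳ m m m²-odd))

theorem2 : (n p k m : ℕ) → n % 2 ≡ 1 → σ n ≡ 2 * n → Prime p →
    p % 4 ≡ 1 → k % 4 ≡ 1 → Coprime p m → n ≡ p ^ k * (m * m) →
    ((p % 8 ≡ 1 → k % 8 ≡ 1 → ¬ (σ (m * m) % 4 ≡ 3))
    × (p % 8 ≡ 1 → k % 8 ≡ 5 → ¬ (σ (m * m) % 4 ≡ 1))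
    × (p % 8 ≡ 5 → k % 8 ≡ 1 → ¬ (σ (m * m) % 4 ≡ 1))
    × (p % 8 ≡ 5 → k % 8 ≡ 5 → ¬ (σ (m * m) % 4 ≡ 3)))
-- The hypothesis k ≡ 1 (mod 4) is implied by each of the four cases.
theorem2 _ p k m n-odd perfect p-prime p≡1 _ p⊥m refl =
  (λ p≡ k≡ → 1≢3 (σm²≡1 (geometric≡ p≡ k≡ refl))) ,
  (λ p≡ k≡ → 3≢1 (σm²≡3 (geometric≡ p≡ k≡ refl))) ,
  (λ p≡ k≡ → 3≢1 (σm²≡3 (geometric≡ p≡ k≡ refl))) ,
  (λ p≡ k≡ → 1≢3 (σm²≡1 (geometric≡ p≡ k≡ refl)))
  where
  σm²*geometric≡2 : (σ (m * m) * geometric p k) % 8 ≡ 2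
  σm²*geometric≡2 = σ[m²]*geometric%8≡2 p-prime p≡1 p⊥m k n-odd perfect

  geometric≡ : ∀ {r j} → p % 8 ≡ r → k % 8 ≡ j → geometric r 8 % 8 ≡ 1 →
               geometric p k % 8 ≡ geometric r j % 8
  geometric≡ refl refl period = geometric-%-reduce 8 8 period k

  σm²≡1 : geometric p k % 8 ≡ 2 → σ (m * m) % 4 ≡ 1
  σm²≡1 = [a*b]%8≡2⇒a%4≡1 (σ (m * m)) (geometric p k) σm²*geometric≡2
  σm²≡3 : geometric p k % 8 ≡ 6 → σ (m * m) % 4 ≡ 3
  σm²≡3 = [a*b]%8≡2⇒a%4≡3 (σ (m * m)) (geometric p k) σm²*geometric≡2

  1≢3 : σ (m * m) % 4 ≡ 1 → ¬ σ (m * m) % 4 ≡ 3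
  1≢3 ≡1 ≡3 with () ← trans (sym ≡1) ≡3
  3≢1 : σ (m * m) % 4 ≡ 3 → ¬ σ (m * m) % 4 ≡ 1
  3≢1 ≡3 ≡1 with () ← trans (sym ≡3) ≡1
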